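{- Let $\gamma\in K^\times$ with $[N_{K/F}(\gamma)]=[1]$ in $J(K)$. Then $[N_{K/K_1}(\gamma)],[N_{K/K_2}(\gamma)]\in J(K)^G$, and: (1) $[N_{K/F}(\gamma)]_F=[1]_F\iff T([N_{K/K_1}(\gamma)])=(1,1,1)\iff T([N_{K/K_2}(\gamma)])=(1,1,1)$; (2) $[N_{K/F}(\gamma)]_F=[a_1]_F\iff T([N_{K/K_1}(\gamma)])=(1,a_1,a_1)\iff T([N_{K/K_2}(\gamma)])=(1,1,a_1)$; (3) $[N_{K/F}(\gamma)]_F=[a_2]_F\iff T([N_{K/K_1}(\gamma)])=(1,1,a_1)\iff T([N_{K/K_2}(\gamma)])=(a_2,1,a_1)$; (4) $[N_{K/F}(\gamma)]_F=[a_1a_2]_F\iff T([N_{K/K_1}(\gamma)])=(1,a_1,1)\iff T([N_{K/K_2}(\gamma)])=(a_2,1,1)$.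
   Context: $F$ is a field with $\operatorname{char}(F)\ne2$, $K=F(\sqrt{a_1},\sqrt{a_2})$ Galois over $F$ with $G=\operatorname{Gal}(K/F)\simeq\mathbb{Z}/2\oplus\mathbb{Z}/2$; $K_1=F(\sqrt{a_1})$, $K_2=F(\sqrt{a_2})$, $K_3=F(\sqrt{a_1a_2})$. $J(K)=K^\times/K^{\times2}$ and $[\cdot]$ denotes classes in it. $[x]_F$ denotes the class of $x\in F^\times\cap K^{\times2}$ in $(F^\times\cap K^{\times2})/F^{\times2}$; $[x]_i$ denotes the class of $x\in K_i^\times\cap K^{\times2}$ in $(K_i^\times\cap K^{\times2})/K_i^{\times2}$. $T:J(K)^G\to\bigoplus_{i=1}^3(K_i^\times\cap K^{\times2})/K_i^{\times2}$ is $T([\gamma])=([N_{K/K_1}(\gamma)]_1,[N_{K/K_2}(\gamma)]_2,[N_{K/K_3}(\gamma)]_3)$, and a value $([u]_1,[v]_2,[w]_3)$ is written $(u,v,w)$. -}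

module Defs where

open import Level using (Level; _⊔_; suc)
open import Algebra.Bundles using (CommutativeRing)
open import Data.Product using (Σ; ∃; _×_; _,_)
open import Relation.Nullary using (¬_)
open import Function.Bundles using (_⇔_)

record Field (c ℓ : Level) : Set (suc (c ⊔ ℓ)) where
  field
    commutativeRing : CommutativeRing c ℓ
  open CommutativeRing commutativeRing public
  field
    0≉1     : ¬ (0# ≈ 1#)
    inverse : ∀ x → ¬ (x ≈ 0#) → ∃ λ y → x * y ≈ 1#

-- The biquadratic extension K = F(√a₁, √a₂), built concretely as the
-- F-algebra with basis 1, α = √a₁, β = √a₂, αβ (α² = a₁, β² = a₂).
module Biquadratic {c ℓ} (F : Field c ℓ) (a₁ a₂ : Field.Carrier F) where
  open Field F

  record K : Set c where
    constructor ⟨_,_,_,_⟩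
    field
      x₀ x₁ x₂ x₃ : Carrier
  open K public

  infix 4 _≈K_
  _≈K_ : K → K → Set ℓ
  x ≈K y = (x₀ x ≈ x₀ y) × (x₁ x ≈ x₁ y) × (x₂ x ≈ x₂ y) × (x₃ x ≈ x₃ y)

  ι : Carrier → K
  ι a = ⟨ a , 0# , 0# , 0# ⟩

  0K 1K : K
  0K = ι 0#
  1K = ι 1#

  infixl 7 _*K_
  _*K_ : K → K → K
  ⟨ x0 , x1 , x2 , x3 ⟩ *K ⟨ y0 , y1 , y2 , y3 ⟩ =
    ⟨ x0 * y0 + a₁ * (x1 * y1) + a₂ * (x2 * y2) + (a₁ * a₂) * (x3 * y3)
    , x0 * y1 + x1 * y0 + a₂ * (x2 * y3 + x3 * y2)
    , x0 * y2 + x2 * y0 + a₁ * (x1 * y3 + x3 * y1)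
    , x0 * y3 + x3 * y0 + x1 * y2 + x2 * y1 ⟩

  -- The Galois group G = {id, σ, τ, στ}:
  -- σ : α ↦ -α, β ↦ β  (fixes K₂);  τ : α ↦ α, β ↦ -β  (fixes K₁);
  -- στ : α ↦ -α, β ↦ -β (fixes K₃ = F(αβ)).
  σ τ στ : K → K
  σ  ⟨ x0 , x1 , x2 , x3 ⟩ = ⟨ x0 , - x1 , x2 , - x3 ⟩
  τ  ⟨ x0 , x1 , x2 , x3 ⟩ = ⟨ x0 , x1 , - x2 , - x3 ⟩
  στ ⟨ x0 , x1 , x2 , x3 ⟩ = ⟨ x0 , - x1 , - x2 , x3 ⟩

  -- subfields K₁ = F(α), K₂ = F(β), K₃ = F(αβ), as subsets of K
  InK₁ InK₂ InK₃ : K → Set ℓ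
  InK₁ x = (x₂ x ≈ 0#) × (x₃ x ≈ 0#)
  InK₂ x = (x₁ x ≈ 0#) × (x₃ x ≈ 0#)
  InK₃ x = (x₁ x ≈ 0#) × (x₂ x ≈ 0#)

  N₁ N₂ N₃ N : K → K
  N₁ γ = γ *K τ γ
  N₂ γ = γ *K σ γ
  N₃ γ = γ *K στ γ
  N  γ = γ *K σ γ *K τ γ *K στ γ

  NonzeroK : K → Set ℓ
  NonzeroK x = ¬ (x ≈K 0K)

  -- [x] = [y] in J(K) = K^×/K^{×2}
  _≡J_ : K → K → Set (c ⊔ ℓ)
  x ≡J y = ∃ λ z → NonzeroK z × (x ≈K y *K (z *K z))

  InJG : K → Set (c ⊔ ℓ)
  InJG x = (σ x ≡J x) × (τ x ≡J x) × (στ x ≡J x)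

  -- [x]_F = [y]_F  (classes in F^× modulo F^{×2}; y ∈ F)
  _≡F_ : K → Carrier → Set (c ⊔ ℓ)
  x ≡F y = ∃ λ z → ¬ (z ≈ 0#) × (x ≈K ι (y * (z * z)))

  -- [x]_i = [y]_i  (classes in K_i^× modulo K_i^{×2})
  _≡₁_ _≡₂_ _≡₃_ : K → K → Set (c ⊔ ℓ)
  x ≡₁ y = ∃ λ z → InK₁ z × NonzeroK z × (x ≈K y *K (z *K z))
  x ≡₂ y = ∃ λ z → InK₂ z × NonzeroK z × (x ≈K y *K (z *K z))
  x ≡₃ y = ∃ λ z → InK₃ z × NonzeroK z × (x ≈K y *K (z *K z))

  T_≣⟨_,_,_⟩ : K → K → K → K → Set (c ⊔ ℓ)
  T x ≣⟨ u , v , w ⟩ = (N₁ x ≡₁ u) × (N₂ x ≡₂ v) × (N₃ x ≡₃ w)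

  Equiv3 : ∀ {p} → Set p → Set p → Set p → Set p
  Equiv3 A B C = (A ⇔ B) × (B ⇔ C)

{-# OPTIONS --safe #-}
module Submission where

-- Write n = N(γ) ∈ F. The norm of N₁γ down to K₂ and to K₃ is N(γ) again, while N₁(N₁γ) = (N₁γ)², so
-- T([N₁γ]) = (1, [n]₂, [n]₃), and likewise T([N₂γ]) = ([n]₁, 1, [n]₃). For d ∈ {a₁, a₂, a₁a₂}, n becomes
-- a square times e in F(√d) exactly when n ∈ e F^{×2} ∪ e d F^{×2}; as the classes of 1, a₁, a₂, a₁a₂ in
-- F^×/F^{×2} are distinct, the classes of n in two different K_i determine its class in F, which gives
-- the four cases. [N₁γ] is G-invariant because τ fixes N₁γ and N₁γ · σ(N₁γ) = N(γ) is a square in K;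
-- n ≠ 0 because K has no nonzero nilpotents.

open import Defs
import Level
open import Level using (_⊔_)
open import Algebra.Bundles using (CommutativeRing; CommutativeMonoid)
open import Algebra.Structures.Biased using (isCommutativeMonoidˡ)
open import Data.Nat.Base as ℕ using (ℕ; suc)
open import Data.Integer.Base as ℤ using (ℤ; +_; -[1+_]; _⊖_; _◃_; sign; ∣_∣)
import Data.Integer.Properties as ℤ
import Data.Nat.Properties as ℕ
open import Data.Sign.Base as Sign using (Sign)
open import Data.Maybe.Base using (just; nothing)
open import Data.Product using (∃; _×_; _,_; proj₁; proj₂)
import Data.Fin.Base as Fin
open import Data.Fin using (#_)
open import Data.Vec.Base using (Vec; []; _∷_; _++_)
open import Function.Base using (_∘_)
open import Relation.Binary.Bundles using (Setoid)
open import Relation.Binary.Structures using (IsEquivalence)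
import Relation.Binary.Reasoning.Setoid as SetoidReasoning
open import Relation.Nullary using (¬_; yes; no)
open import Function.Bundles using (_⇔_; mk⇔)
open import Function.Construct.Symmetry using (⇔-sym)
open import Function.Construct.Composition using () renaming (equivalence to ⇔-trans)
open import Data.Empty using (⊥-elim)
open import Relation.Binary.PropositionalEquality as ≡ using (_≡_; _≢_)
open import Data.Bool.Base using (Bool; true; false; _xor_; _∧_)
open import Data.Bool.Properties using (xor-same; xor-assoc; xor-identityʳ; not-injective)
open import Data.Product.Properties using (,-injectiveˡ; ,-injectiveʳ)

-- The solvers of the library use the carrier of an abstract ring as coefficient ring, where x - x does
-- not normalise to 0; coefficients in ℤ, mapped into the ring, do.
module IntegerCoefficientSolver {c ℓ} (R : CommutativeRing c ℓ) where
  open CommutativeRing R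
  open import Algebra.Properties.Ring ring using (-0#≈0#; -‿involutive; -‿distribˡ-*; -‿distribʳ-*; -‿+-comm)
  open import Algebra.Properties.Semiring.Mult.TCOptimised semiring using (1+×; ×-homo-+; ×1-homo-*) renaming (_×_ to _·_)
  open import Algebra.Solver.Ring.AlmostCommutativeRing using (fromCommutativeRing; _-Raw-AlmostCommutative⟶_; Induced-equivalence)
  open import Relation.Binary.Definitions using (WeaklyDecidable)
  open import Algebra.Properties.CommutativeSemigroup +-commutativeSemigroup using (interchange)
  open import Relation.Binary.Reasoning.Setoid setoid

  signed : Sign → Carrier → Carrier
  signed Sign.+ x = x
  signed Sign.- x = - x

  ⟦_⟧ℤ : ℤ → Carrier
  ⟦ i ⟧ℤ = signed (sign i) (∣ i ∣ · 1#)

  signed-cong : ∀ s {x y} → x ≈ y → signed s x ≈ signed s y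
  signed-cong Sign.+ x≈y = x≈y
  signed-cong Sign.- x≈y = -‿cong x≈y

  signed-* : ∀ s t x y → signed (s Sign.* t) (x * y) ≈ signed s x * signed t y
  signed-* Sign.+ Sign.+ x y = refl
  signed-* Sign.+ Sign.- x y = -‿distribʳ-* x y
  signed-* Sign.- Sign.+ x y = -‿distribˡ-* x y
  signed-* Sign.- Sign.- x y = begin
    x * y         ≈⟨ -‿involutive (x * y) ⟨
    - - (x * y)   ≈⟨ -‿cong (-‿distribˡ-* x y) ⟩
    - (- x * y)   ≈⟨ -‿distribʳ-* (- x) y ⟩
    - x * - y     ∎

  ⟦◃⟧ : ∀ s n → ⟦ s ◃ n ⟧ℤ ≈ signed s (n · 1#)
  ⟦◃⟧ Sign.+ 0       = refl
  ⟦◃⟧ Sign.- 0       = sym -0#≈0#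
  ⟦◃⟧ Sign.+ (suc n) = refl
  ⟦◃⟧ Sign.- (suc n) = refl

  *-homo : ∀ i j → ⟦ i ℤ.* j ⟧ℤ ≈ ⟦ i ⟧ℤ * ⟦ j ⟧ℤ
  *-homo i j = begin
    ⟦ (sign i Sign.* sign j) ◃ (∣ i ∣ ℕ.* ∣ j ∣) ⟧ℤ       ≈⟨ ⟦◃⟧ (sign i Sign.* sign j) (∣ i ∣ ℕ.* ∣ j ∣) ⟩
    signed (sign i Sign.* sign j) ((∣ i ∣ ℕ.* ∣ j ∣) · 1#) ≈⟨ signed-cong (sign i Sign.* sign j) (×1-homo-* ∣ i ∣ ∣ j ∣) ⟩
    signed (sign i Sign.* sign j) ((∣ i ∣ · 1#) * (∣ j ∣ · 1#)) ≈⟨ signed-* (sign i) (sign j) _ _ ⟩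
    ⟦ i ⟧ℤ * ⟦ j ⟧ℤ ∎

  ⊖-homo : ∀ m n → ⟦ m ⊖ n ⟧ℤ ≈ m · 1# - n · 1#
  ⊖-homo m 0 = begin
    ⟦ m ⊖ ℕ.zero ⟧ℤ     ≡⟨ ≡.cong ⟦_⟧ℤ (ℤ.⊖-≥ {m} ℕ.z≤n) ⟩
    m · 1#         ≈⟨ +-identityʳ _ ⟨
    m · 1# + 0#    ≈⟨ +-congˡ -0#≈0# ⟨
    m · 1# - 0#    ∎
  ⊖-homo 0 (suc n) = sym (+-identityˡ _)
  ⊖-homo (suc m) (suc n) = begin
    ⟦ suc m ⊖ suc n ⟧ℤ                    ≡⟨ ≡.cong ⟦_⟧ℤ (ℤ.[1+m]⊖[1+n]≡m⊖n m n) ⟩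
    ⟦ m ⊖ n ⟧ℤ                            ≈⟨ ⊖-homo m n ⟩
    m · 1# - n · 1#                        ≈⟨ +-identityˡ _ ⟨
    0# + (m · 1# - n · 1#)                 ≈⟨ +-congʳ (-‿inverseʳ 1#) ⟨
    (1# - 1#) + (m · 1# - n · 1#)          ≈⟨ interchange 1# (- 1#) (m · 1#) (- (n · 1#)) ⟩
    (1# + m · 1#) + (- 1# - n · 1#)        ≈⟨ +-congˡ (-‿+-comm 1# (n · 1#)) ⟩
    (1# + m · 1#) - (1# + n · 1#)          ≈⟨ +-cong (1+× m 1#) (-‿cong (1+× n 1#)) ⟨
    suc m · 1# - suc n · 1#               ∎

  +-homo : ∀ i j → ⟦ i ℤ.+ j ⟧ℤ ≈ ⟦ i ⟧ℤ + ⟦ j ⟧ℤ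
  +-homo (+ m)    (+ n)    = ×-homo-+ 1# m n
  +-homo (+ m)    -[1+ n ] = ⊖-homo m (suc n)
  +-homo -[1+ m ] (+ n)    = trans (⊖-homo n (suc m)) (+-comm _ _)
  +-homo -[1+ m ] -[1+ n ] = begin
    - (suc (suc (m ℕ.+ n)) · 1#)         ≡⟨ ≡.cong (λ k → - (k · 1#)) (ℕ.+-suc (suc m) n) ⟨
    - ((suc m ℕ.+ suc n) · 1#)           ≈⟨ -‿cong (×-homo-+ 1# (suc m) (suc n)) ⟩
    - (suc m · 1# + suc n · 1#)          ≈⟨ -‿+-comm _ _ ⟨
    - (suc m · 1#) - suc n · 1#          ∎

  -‿homo : ∀ i → ⟦ ℤ.- i ⟧ℤ ≈ - ⟦ i ⟧ℤ
  -‿homo (+ 0)       = sym -0#≈0#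
  -‿homo (+ (suc n)) = refl
  -‿homo -[1+ n ]    = sym (-‿involutive _)

  homomorphism : ℤ.+-*-rawRing -Raw-AlmostCommutative⟶ fromCommutativeRing R
  homomorphism = record
    { ⟦_⟧ = ⟦_⟧ℤ ; +-homo = +-homo ; *-homo = *-homo ; -‿homo = -‿homo
    ; 0-homo = refl ; 1-homo = refl }

  coefficient-equal? : WeaklyDecidable (Induced-equivalence homomorphism)
  coefficient-equal? i j with i ℤ.≟ j
  ... | yes ≡.refl = just refl
  ... | no _       = nothing

  open import Algebra.Solver.Ring ℤ.+-*-rawRing (fromCommutativeRing R) homomorphism coefficient-equal? public

module FieldProperties {c ℓ} (F : Field c ℓ) where
  open Field F
  open IntegerCoefficientSolver commutativeRing using (solve; _:=_; _:+_; _:*_; _:-_; con)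
  open import Relation.Binary.Reasoning.Setoid setoid

  private variable
    d p q x y w : Carrier

  1≉0 : ¬ 1# ≈ 0#
  1≉0 1≈0 = 0≉1 (sym 1≈0)

  x*y≈0⇒y≈0 : ¬ x ≈ 0# → x * y ≈ 0# → y ≈ 0#
  x*y≈0⇒y≈0 {x} {y} x≉0 xy≈0 with inverse x x≉0
  ... | x⁻¹ , xx⁻¹≈1 = begin
    y                ≈⟨ *-identityˡ y ⟨
    1# * y           ≈⟨ *-congʳ xx⁻¹≈1 ⟨
    (x * x⁻¹) * y    ≈⟨ solve 3 (λ x x⁻¹ y → (x :* x⁻¹) :* y := x⁻¹ :* (x :* y)) refl x x⁻¹ y ⟩
    x⁻¹ * (x * y)    ≈⟨ *-congˡ xy≈0 ⟩
    x⁻¹ * 0#         ≈⟨ zeroʳ x⁻¹ ⟩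
    0#               ∎

  *-≉0 : ¬ x ≈ 0# → ¬ y ≈ 0# → ¬ x * y ≈ 0#
  *-≉0 x≉0 y≉0 xy≈0 = y≉0 (x*y≈0⇒y≈0 x≉0 xy≈0)

  IsSquare : Carrier → Set (c ⊔ ℓ)
  IsSquare t = ∃ λ x → x * x ≈ t

  infix 4 _∼_
  _∼_ : Carrier → Carrier → Set (c ⊔ ℓ)
  x ∼ y = ∃ λ z → ¬ z ≈ 0# × x ≈ y * (z * z)

  ∼-sym : x ∼ y → y ∼ x
  ∼-sym {x} {y} (z , z≉0 , x≈yz²) with inverse z z≉0
  ... | z⁻¹ , zz⁻¹≈1 = z⁻¹ , z⁻¹≉0 , (begin
    y                                ≈⟨ solve 1 (λ y → y := y :* (con (+ 1) :* con (+ 1))) refl y ⟩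
    y * (1# * 1#)                    ≈⟨ *-congˡ (*-cong zz⁻¹≈1 zz⁻¹≈1) ⟨
    y * ((z * z⁻¹) * (z * z⁻¹))      ≈⟨ solve 3 (λ y z z⁻¹ → y :* ((z :* z⁻¹) :* (z :* z⁻¹))
                                                             := (y :* (z :* z)) :* (z⁻¹ :* z⁻¹)) refl y z z⁻¹ ⟩
    (y * (z * z)) * (z⁻¹ * z⁻¹)      ≈⟨ *-congʳ x≈yz² ⟨
    x * (z⁻¹ * z⁻¹)                  ∎)
    where
    z⁻¹≉0 : ¬ z⁻¹ ≈ 0#
    z⁻¹≉0 z⁻¹≈0 = 0≉1 (trans (sym (trans (*-congˡ z⁻¹≈0) (zeroʳ z))) zz⁻¹≈1)

  ∼-trans : x ∼ y → y ∼ w → x ∼ w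
  ∼-trans {x} {y} {w} (z , z≉0 , x≈yz²) (z′ , z′≉0 , y≈wz′²) = z′ * z , *-≉0 z′≉0 z≉0 , (begin
    x                                ≈⟨ x≈yz² ⟩
    y * (z * z)                      ≈⟨ *-congʳ y≈wz′² ⟩
    (w * (z′ * z′)) * (z * z)        ≈⟨ solve 3 (λ w z′ z → (w :* (z′ :* z′)) :* (z :* z)
                                                             := w :* ((z′ :* z) :* (z′ :* z))) refl w z′ z ⟩
    w * ((z′ * z) * (z′ * z))        ∎)

  ∼-*-congʳ : x ∼ y → x * w ∼ y * w
  ∼-*-congʳ {x} {y} {w} (z , z≉0 , x≈yz²) = z , z≉0 , (begin
    x * w                  ≈⟨ *-congʳ x≈yz² ⟩
    (y * (z * z)) * w      ≈⟨ solve 3 (λ y z w → (y :* (z :* z)) :* w := (y :* w) :* (z :* z)) refl y z w ⟩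
    (y * w) * (z * z)      ∎)

  nonsquare⇒≉0 : ¬ IsSquare x → ¬ x ≈ 0#
  nonsquare⇒≉0 x-nonsquare x≈0 = x-nonsquare (0# , trans (zeroˡ 0#) (sym x≈0))

  x*x∼1 : ¬ x ≈ 0# → x * x ∼ 1#
  x*x∼1 {x} x≉0 = x , x≉0 , sym (*-identityˡ (x * x))

  ∼1⇒IsSquare : x ∼ 1# → IsSquare x
  ∼1⇒IsSquare {x} (z , _ , x≈1z²) = z , sym (trans x≈1z² (*-identityˡ (z * z)))

  module _ (2≉0 : ¬ 1# + 1# ≈ 0#) where

    x*y+y*x≈0⇒x*y≈0 : x * y + y * x ≈ 0# → x * y ≈ 0#
    x*y+y*x≈0⇒x*y≈0 {x} {y} h = x*y≈0⇒y≈0 2≉0 (trans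
      (solve 2 (λ x y → (con (+ 1) :+ con (+ 1)) :* (x :* y) := x :* y :+ y :* x) refl x y) h)

    -- (p + q √d)² = (p² + d q²) + (pq + qp) √d, so this says that F[√d] has no nonzero nilpotents.
    quadratic-square≈0⇒¬¬≈0 : ¬ d ≈ 0# → p * p + d * (q * q) ≈ 0# → p * q + q * p ≈ 0# →
                              ¬ ¬ (p ≈ 0# × q ≈ 0#)
    quadratic-square≈0⇒¬¬≈0 {d} {p} {q} d≉0 norm≈0 trace≈0 ¬both =
      p≉0⇒⊥ (λ p≈0 → q≉0⇒⊥ p≈0 (λ q≈0 → ¬both (p≈0 , q≈0)))
      where
      pq≈0 : p * q ≈ 0#
      pq≈0 = x*y+y*x≈0⇒x*y≈0 trace≈0

      p⁴≈0 : (p * p) * (p * p) ≈ 0#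
      p⁴≈0 = begin
        (p * p) * (p * p)                                          ≈⟨ expand ⟩
        (p * p) * (p * p + d * (q * q)) - d * ((p * q) * (p * q))  ≈⟨ +-cong (*-congˡ norm≈0) (-‿cong (*-congˡ (*-cong pq≈0 pq≈0))) ⟩
        (p * p) * 0# - d * (0# * 0#)                               ≈⟨ collapse ⟩
        0#                                                         ∎
        where
        expand = solve 3 (λ d p q → (p :* p) :* (p :* p)
                                 := (p :* p) :* (p :* p :+ d :* (q :* q)) :- d :* ((p :* q) :* (p :* q))) refl d p q
        collapse = solve 2 (λ d p → (p :* p) :* con (+ 0) :- d :* (con (+ 0) :* con (+ 0)) := con (+ 0)) refl d p

      p≉0⇒⊥ : ¬ ¬ p ≈ 0#
      p≉0⇒⊥ p≉0 = *-≉0 (*-≉0 p≉0 p≉0) (*-≉0 p≉0 p≉0) p⁴≈0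

      q≉0⇒⊥ : p ≈ 0# → ¬ ¬ q ≈ 0#
      q≉0⇒⊥ p≈0 q≉0 = *-≉0 d≉0 (*-≉0 q≉0 q≉0) (begin
        d * (q * q)                 ≈⟨ +-identityˡ _ ⟨
        0# + d * (q * q)            ≈⟨ +-congʳ (trans (*-cong p≈0 p≈0) (zeroˡ 0#)) ⟨
        p * p + d * (q * q)         ≈⟨ norm≈0 ⟩
        0#                          ∎)

-- (s , t) stands for the square class of a₁^s a₂^t.
Code : Set
Code = Bool × Bool

0ᶜ : Code
0ᶜ = false , false

infixl 6 _⊕_
infixl 7 _∧ᶜ_
_⊕_ _∧ᶜ_ : Code → Code → Code
(s , t) ⊕ (s′ , t′) = s xor s′ , t xor t′
(s , t) ∧ᶜ (s′ , t′) = s ∧ s′ , t ∧ t′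

⊕-self : ∀ u → u ⊕ u ≡ 0ᶜ
⊕-self (s , t) = ≡.cong₂ _,_ (xor-same s) (xor-same t)

⊕-involutive : ∀ u d → (u ⊕ d) ⊕ d ≡ u
⊕-involutive (s , t) (s′ , t′) = ≡.cong₂ _,_ (xor-xor s s′) (xor-xor t t′)
  where
  xor-xor : ∀ a b → (a xor b) xor b ≡ a
  xor-xor a b = ≡.trans (xor-assoc a b b) (≡.trans (≡.cong (a xor_) (xor-same b)) (xor-identityʳ a))

⊕-cancelˡ : ∀ u {d d′} → u ⊕ d ≡ u ⊕ d′ → d ≡ d′
⊕-cancelˡ (s , t) eq = ≡.cong₂ _,_ (xor-cancelˡ s (,-injectiveˡ eq)) (xor-cancelˡ t (,-injectiveʳ eq))
  where
  xor-cancelˡ : ∀ a {b b′} → a xor b ≡ a xor b′ → b ≡ b′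
  xor-cancelˡ false eq = eq
  xor-cancelˡ true  eq = not-injective eq

⊕-identityʳ : ∀ u → u ⊕ 0ᶜ ≡ u
⊕-identityʳ (s , t) = ≡.cong₂ _,_ (xor-identityʳ s) (xor-identityʳ t)

module CommutativeMonoidProperties {c ℓ} (M : CommutativeMonoid c ℓ) where
  open CommutativeMonoid M
  open import Algebra.Solver.CommutativeMonoid M using (solve; _⊜_) renaming (_⊕_ to _⊙_)
  open import Relation.Binary.Reasoning.Setoid setoid

  square-ratio : ∀ {m m′ s s′ z} → m ∙ m′ ≈ s → z ∙ z ≈ s → s ∙ s′ ≈ ε →
                 m′ ≈ m ∙ ((m′ ∙ (s′ ∙ z)) ∙ (m′ ∙ (s′ ∙ z)))
  square-ratio {m} {m′} {s} {s′} {z} mm′≈s zz≈s ss′≈ε = sym (begin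
    m ∙ ((m′ ∙ (s′ ∙ z)) ∙ (m′ ∙ (s′ ∙ z)))  ≈⟨ solve 4 (λ m m′ s′ z → m ⊙ ((m′ ⊙ (s′ ⊙ z)) ⊙ (m′ ⊙ (s′ ⊙ z)))
                                                                 ⊜ (m ⊙ m′) ⊙ (m′ ⊙ ((s′ ⊙ s′) ⊙ (z ⊙ z)))) refl m m′ s′ z ⟩
    (m ∙ m′) ∙ (m′ ∙ ((s′ ∙ s′) ∙ (z ∙ z)))  ≈⟨ ∙-cong mm′≈s (∙-congˡ (∙-congˡ zz≈s)) ⟩
    s ∙ (m′ ∙ ((s′ ∙ s′) ∙ s))              ≈⟨ solve 3 (λ s m′ s′ → s ⊙ (m′ ⊙ ((s′ ⊙ s′) ⊙ s))
                                                              ⊜ m′ ⊙ ((s ⊙ s′) ⊙ (s ⊙ s′))) refl s m′ s′ ⟩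
    m′ ∙ ((s ∙ s′) ∙ (s ∙ s′))              ≈⟨ ∙-congˡ (∙-cong ss′≈ε ss′≈ε) ⟩
    m′ ∙ (ε ∙ ε)                            ≈⟨ trans (∙-congˡ (identityˡ ε)) (identityʳ m′) ⟩
    m′                                      ∎)

  square-ratio-root : ∀ {m′ s s′ z} → z ∙ z ≈ s → s ∙ s′ ≈ ε → m′ ≈ (m′ ∙ (s′ ∙ z)) ∙ z
  square-ratio-root {m′} {s} {s′} {z} zz≈s ss′≈ε = sym (begin
    (m′ ∙ (s′ ∙ z)) ∙ z    ≈⟨ solve 3 (λ m′ s′ z → (m′ ⊙ (s′ ⊙ z)) ⊙ z ⊜ m′ ⊙ ((z ⊙ z) ⊙ s′)) refl m′ s′ z ⟩
    m′ ∙ ((z ∙ z) ∙ s′)    ≈⟨ ∙-congˡ (trans (∙-congʳ zz≈s) ss′≈ε) ⟩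
    m′ ∙ ε                 ≈⟨ identityʳ m′ ⟩
    m′                     ∎)

module BiquadraticProperties {c ℓ} (F : Field c ℓ) (a₁ a₂ : Field.Carrier F) where
  open Field F
  open Biquadratic F a₁ a₂
  open FieldProperties F
  open IntegerCoefficientSolver commutativeRing
    using (Polynomial; var; con; _:+_; _:*_; :-_; _:-_; Normal; normalise; ⟦_⟧N; prove; solve; _:=_)
    renaming (⟦_⟧ to ⟦_⟧ₚ)

  private variable
    m : ℕ

  ≈K-isEquivalence : IsEquivalence _≈K_
  ≈K-isEquivalence = record
    { refl  = refl , refl , refl , refl
    ; sym   = λ (e₀ , e₁ , e₂ , e₃) → sym e₀ , sym e₁ , sym e₂ , sym e₃
    ; trans = λ (e₀ , e₁ , e₂ , e₃) (f₀ , f₁ , f₂ , f₃) → trans e₀ f₀ , trans e₁ f₁ , trans e₂ f₂ , trans e₃ f₃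
    }

  K-setoid : Setoid c ℓ
  K-setoid = record { isEquivalence = ≈K-isEquivalence }

  open Setoid K-setoid public using () renaming (refl to ≈K-refl; sym to ≈K-sym; trans to ≈K-trans)

  *K-cong : ∀ {x x′ y y′} → x ≈K x′ → y ≈K y′ → x *K y ≈K x′ *K y′
  *K-cong (e₀ , e₁ , e₂ , e₃) (f₀ , f₁ , f₂ , f₃) =
    +-cong (+-cong (+-cong (*-cong e₀ f₀) (*-congˡ (*-cong e₁ f₁))) (*-congˡ (*-cong e₂ f₂))) (*-congˡ (*-cong e₃ f₃)) ,
    +-cong (+-cong (*-cong e₀ f₁) (*-cong e₁ f₀)) (*-congˡ (+-cong (*-cong e₂ f₃) (*-cong e₃ f₂))) ,
    +-cong (+-cong (*-cong e₀ f₂) (*-cong e₂ f₀)) (*-congˡ (+-cong (*-cong e₁ f₃) (*-cong e₃ f₁))) ,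
    +-cong (+-cong (+-cong (*-cong e₀ f₃) (*-cong e₃ f₀)) (*-cong e₁ f₂)) (*-cong e₂ f₁)

  *K-congˡ : ∀ {x y y′} → y ≈K y′ → x *K y ≈K x *K y′
  *K-congˡ = *K-cong ≈K-refl

  ι-cong : ∀ {p q} → p ≈ q → ι p ≈K ι q
  ι-cong p≈q = p≈q , refl , refl , refl

  -- Elements of K whose coordinates are polynomials over ℤ in a₁, a₂ (variables 0 and 1) and m further
  -- variables; the operations below mirror those of K clause by clause, so evaluation commutes with
  -- them definitionally and identities in K reduce to four identities of the ring solver.
  record KPoly (m : ℕ) : Set where
    constructor ⟪_,_,_,_⟫
    field π₀ π₁ π₂ π₃ : Polynomial (2 ℕ.+ m)
  open KPoly

  ⟦_⟧ᴷ : KPoly m → Vec Carrier m → K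
  ⟦ P ⟧ᴷ ρ = ⟨ ⟦ π₀ P ⟧ₚ ρ′ , ⟦ π₁ P ⟧ₚ ρ′ , ⟦ π₂ P ⟧ₚ ρ′ , ⟦ π₃ P ⟧ₚ ρ′ ⟩
    where ρ′ = a₁ ∷ a₂ ∷ ρ

  normaliseᴷ : KPoly m → Normal (2 ℕ.+ m) × Normal (2 ℕ.+ m) × Normal (2 ℕ.+ m) × Normal (2 ℕ.+ m)
  normaliseᴷ P = normalise (π₀ P) , normalise (π₁ P) , normalise (π₂ P) , normalise (π₃ P)

  proveᴾ : (ρ : Vec Carrier m) (p q : Polynomial (2 ℕ.+ m)) → normalise p ≡ normalise q →
           ⟦ p ⟧ₚ (a₁ ∷ a₂ ∷ ρ) ≈ ⟦ q ⟧ₚ (a₁ ∷ a₂ ∷ ρ)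
  proveᴾ ρ p q eq = prove (a₁ ∷ a₂ ∷ ρ) p q (reflexive (≡.cong (λ nf → ⟦ nf ⟧N (a₁ ∷ a₂ ∷ ρ)) eq))

  proveᴷ : (ρ : Vec Carrier m) (P Q : KPoly m) → normaliseᴷ P ≡ normaliseᴷ Q → ⟦ P ⟧ᴷ ρ ≈K ⟦ Q ⟧ᴷ ρ
  proveᴷ ρ P Q eq =
    proveᴾ ρ (π₀ P) (π₀ Q) (≡.cong proj₁ eq) ,
    proveᴾ ρ (π₁ P) (π₁ Q) (≡.cong (proj₁ ∘ proj₂) eq) ,
    proveᴾ ρ (π₂ P) (π₂ Q) (≡.cong (proj₁ ∘ proj₂ ∘ proj₂) eq) ,
    proveᴾ ρ (π₃ P) (π₃ Q) (≡.cong (proj₂ ∘ proj₂ ∘ proj₂) eq)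

  A₁ A₂ 0ᴾ 1ᴾ : Polynomial (2 ℕ.+ m)
  A₁ = var Fin.zero
  A₂ = var (Fin.suc Fin.zero)
  0ᴾ = con (+ 0)
  1ᴾ = con (+ 1)

  infixl 7 _⊛_
  _⊛_ : KPoly m → KPoly m → KPoly m
  ⟪ x0 , x1 , x2 , x3 ⟫ ⊛ ⟪ y0 , y1 , y2 , y3 ⟫ =
    ⟪ x0 :* y0 :+ A₁ :* (x1 :* y1) :+ A₂ :* (x2 :* y2) :+ (A₁ :* A₂) :* (x3 :* y3)
    , x0 :* y1 :+ x1 :* y0 :+ A₂ :* (x2 :* y3 :+ x3 :* y2)
    , x0 :* y2 :+ x2 :* y0 :+ A₁ :* (x1 :* y3 :+ x3 :* y1)
    , x0 :* y3 :+ x3 :* y0 :+ x1 :* y2 :+ x2 :* y1 ⟫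

  ιᴾ : Polynomial (2 ℕ.+ m) → KPoly m
  ιᴾ p = ⟪ p , 0ᴾ , 0ᴾ , 0ᴾ ⟫

  σᴾ τᴾ στᴾ N₁ᴾ N₂ᴾ N₃ᴾ Nᴾ : KPoly m → KPoly m
  σᴾ  ⟪ x0 , x1 , x2 , x3 ⟫ = ⟪ x0 , :- x1 , x2 , :- x3 ⟫
  τᴾ  ⟪ x0 , x1 , x2 , x3 ⟫ = ⟪ x0 , x1 , :- x2 , :- x3 ⟫
  στᴾ ⟪ x0 , x1 , x2 , x3 ⟫ = ⟪ x0 , :- x1 , :- x2 , x3 ⟫
  N₁ᴾ P = P ⊛ τᴾ P
  N₂ᴾ P = P ⊛ σᴾ P
  N₃ᴾ P = P ⊛ στᴾ P
  Nᴾ  P = P ⊛ σᴾ P ⊛ τᴾ P ⊛ στᴾ P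

  coordinates : K → Vec Carrier 4
  coordinates x = x₀ x ∷ x₁ x ∷ x₂ x ∷ x₃ x ∷ []

  X : KPoly 4
  X = ⟪ var (# 2) , var (# 3) , var (# 4) , var (# 5) ⟫

  *K-assoc : ∀ x y z → (x *K y) *K z ≈K x *K (y *K z)
  *K-assoc x y z = proveᴷ (coordinates x ++ coordinates y ++ coordinates z) ((X′ ⊛ Y′) ⊛ Z′) (X′ ⊛ (Y′ ⊛ Z′)) ≡.refl
    where
    X′ Y′ Z′ : KPoly 12
    X′ = ⟪ var (# 2) , var (# 3) , var (# 4) , var (# 5) ⟫
    Y′ = ⟪ var (# 6) , var (# 7) , var (# 8) , var (# 9) ⟫
    Z′ = ⟪ var (# 10) , var (# 11) , var (# 12) , var (# 13) ⟫

  *K-comm : ∀ x y → x *K y ≈K y *K x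
  *K-comm x y = proveᴷ (coordinates x ++ coordinates y) (X′ ⊛ Y′) (Y′ ⊛ X′) ≡.refl
    where
    X′ Y′ : KPoly 8
    X′ = ⟪ var (# 2) , var (# 3) , var (# 4) , var (# 5) ⟫
    Y′ = ⟪ var (# 6) , var (# 7) , var (# 8) , var (# 9) ⟫

  *K-identityˡ : ∀ x → 1K *K x ≈K x
  *K-identityˡ x = proveᴷ (coordinates x) (ιᴾ 1ᴾ ⊛ X) X ≡.refl

  *K-zeroˡ : ∀ x → 0K *K x ≈K 0K
  *K-zeroˡ x = proveᴷ (coordinates x) (ιᴾ 0ᴾ ⊛ X) (ιᴾ 0ᴾ) ≡.refl

  *K≈ι⇒≉0 : ∀ {x y n} → x *K y ≈K ι n → ¬ n ≈ 0# → NonzeroK x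
  *K≈ι⇒≉0 {x} {y} xy≈n n≉0 x≈0 =
    n≉0 (proj₁ (≈K-trans (≈K-sym xy≈n) (≈K-trans (*K-cong x≈0 ≈K-refl) (*K-zeroˡ y))))

  ι-* : ∀ p q → ι p *K ι q ≈K ι (p * q)
  ι-* p q = proveᴷ (p ∷ q ∷ []) (ιᴾ (var (# 2)) ⊛ ιᴾ (var (# 3))) (ιᴾ (var (# 2) :* var (# 3))) ≡.refl

  N≈ι : ∀ x → N x ≈K ι (x₀ (N x))
  N≈ι x = proveᴷ (coordinates x) (Nᴾ X) (ιᴾ (π₀ (Nᴾ X))) ≡.refl

  N₂∘N₁≈N : ∀ x → N₂ (N₁ x) ≈K N x
  N₂∘N₁≈N x = proveᴷ (coordinates x) (N₂ᴾ (N₁ᴾ X)) (Nᴾ X) ≡.refl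

  N₃∘N₁≈N : ∀ x → N₃ (N₁ x) ≈K N x
  N₃∘N₁≈N x = proveᴷ (coordinates x) (N₃ᴾ (N₁ᴾ X)) (Nᴾ X) ≡.refl

  N₁∘N₂≈N : ∀ x → N₁ (N₂ x) ≈K N x
  N₁∘N₂≈N x = proveᴷ (coordinates x) (N₁ᴾ (N₂ᴾ X)) (Nᴾ X) ≡.refl

  N₃∘N₂≈N : ∀ x → N₃ (N₂ x) ≈K N x
  N₃∘N₂≈N x = proveᴷ (coordinates x) (N₃ᴾ (N₂ᴾ X)) (Nᴾ X) ≡.refl

  τ∘N₁≈N₁ : ∀ x → τ (N₁ x) ≈K N₁ x
  τ∘N₁≈N₁ x = proveᴷ (coordinates x) (τᴾ (N₁ᴾ X)) (N₁ᴾ X) ≡.refl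

  σ∘N₂≈N₂ : ∀ x → σ (N₂ x) ≈K N₂ x
  σ∘N₂≈N₂ x = proveᴷ (coordinates x) (σᴾ (N₂ᴾ X)) (N₂ᴾ X) ≡.refl

  στ∘N₁≈σ∘N₁ : ∀ x → στ (N₁ x) ≈K σ (N₁ x)
  στ∘N₁≈σ∘N₁ x = proveᴷ (coordinates x) (στᴾ (N₁ᴾ X)) (σᴾ (N₁ᴾ X)) ≡.refl

  στ∘N₂≈τ∘N₂ : ∀ x → στ (N₂ x) ≈K τ (N₂ x)
  στ∘N₂≈τ∘N₂ x = proveᴷ (coordinates x) (στᴾ (N₂ᴾ X)) (τᴾ (N₂ᴾ X)) ≡.refl

  *K-commutativeMonoid : CommutativeMonoid c ℓ
  *K-commutativeMonoid = record
    { isCommutativeMonoid = isCommutativeMonoidˡ (record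
      { isSemigroup = record
        { isMagma = record { isEquivalence = ≈K-isEquivalence ; ∙-cong = *K-cong }
        ; assoc   = *K-assoc
        }
      ; identityˡ = *K-identityˡ
      ; comm      = *K-comm
      })
    }

  ⟦_⟧ : Code → Carrier
  ⟦ false , false ⟧ = 1#
  ⟦ true  , false ⟧ = a₁
  ⟦ false , true  ⟧ = a₂
  ⟦ true  , true  ⟧ = a₁ * a₂

  -- F(√⟦ δ ⟧) inside K: emb p q = p + q √⟦ δ ⟧, and ρ generates Gal(K / F(√⟦ δ ⟧)).
  record QuadraticSubfield : Set (c ⊔ Level.suc ℓ) where
    field
      δ     : Code
      In    : K → Set ℓ
      coord : K → Carrier
      emb   : Carrier → Carrier → K
      ρ     : K → K
      In-emb        : ∀ p q → In (emb p q)
      In⇒≈emb       : ∀ {w} → In w → w ≈K emb (x₀ w) (coord w)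
      coord-zero    : ∀ {x} → x ≈K 0K → coord x ≈ 0#
      emb-cong      : ∀ {p p′ q q′} → p ≈ p′ → q ≈ q′ → emb p q ≈K emb p′ q′
      emb-injective : ∀ {p p′ q q′} → emb p q ≈K emb p′ q′ → p ≈ p′ × q ≈ q′
      ι≈emb         : ∀ p → ι p ≈K emb p 0#
      ι*emb²        : ∀ e p q → ι e *K (emb p q *K emb p q) ≈K
                                emb (e * (p * p + ⟦ δ ⟧ * (q * q))) (e * (p * q + q * p))
      norm-In       : ∀ z → In (z *K ρ z)
      norm-square   : ∀ z → (z *K ρ z) *K (z *K ρ z) ≈K (z *K z) *K (ρ z *K ρ z)
      trace₀        : ∀ z → x₀ (z *K z) + x₀ (z *K ρ z) ≈
                            (1# + 1#) * (x₀ z * x₀ z + ⟦ δ ⟧ * (coord z * coord z))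
      trace₁        : ∀ z → coord (z *K z) + coord (z *K ρ z) ≈
                            (1# + 1#) * (x₀ z * coord z + coord z * x₀ z)

  2ᴾ : Polynomial (2 ℕ.+ m)
  2ᴾ = 1ᴾ :+ 1ᴾ

  X₀ X₁ X₂ X₃ : Polynomial 6
  X₀ = π₀ X
  X₁ = π₁ X
  X₂ = π₂ X
  X₃ = π₃ X

  E P Q : Polynomial 5
  E = var (# 2)
  P = var (# 3)
  Q = var (# 4)

  K₁ : QuadraticSubfield
  K₁ = record
    { δ = true , false ; In = InK₁ ; coord = x₁ ; emb = λ p q → ⟨ p , q , 0# , 0# ⟩ ; ρ = τ
    ; In-emb        = λ _ _ → refl , refl
    ; In⇒≈emb       = λ (w₂≈0 , w₃≈0) → refl , refl , w₂≈0 , w₃≈0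
    ; coord-zero    = λ (_ , e₁ , _ , _) → e₁
    ; emb-cong      = λ p≈p′ q≈q′ → p≈p′ , q≈q′ , refl , refl
    ; emb-injective = λ (e₀ , e₁ , _ , _) → e₀ , e₁
    ; ι≈emb         = λ _ → ≈K-refl
    ; ι*emb²        = λ e p q → proveᴷ (e ∷ p ∷ q ∷ []) (ιᴾ E ⊛ (embᴾ P Q ⊛ embᴾ P Q))
                        (embᴾ (E :* (P :* P :+ A₁ :* (Q :* Q))) (E :* (P :* Q :+ Q :* P))) ≡.refl
    ; norm-In       = λ z → proveᴾ (coordinates z) (π₂ (N₁ᴾ X)) 0ᴾ ≡.refl ,
                            proveᴾ (coordinates z) (π₃ (N₁ᴾ X)) 0ᴾ ≡.refl
    ; norm-square   = λ z → proveᴷ (coordinates z) (N₁ᴾ X ⊛ N₁ᴾ X) ((X ⊛ X) ⊛ (τᴾ X ⊛ τᴾ X)) ≡.refl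
    ; trace₀        = λ z → proveᴾ (coordinates z) (π₀ (X ⊛ X) :+ π₀ (N₁ᴾ X))
                            (2ᴾ :* (X₀ :* X₀ :+ A₁ :* (X₁ :* X₁))) ≡.refl
    ; trace₁        = λ z → proveᴾ (coordinates z) (π₁ (X ⊛ X) :+ π₁ (N₁ᴾ X))
                            (2ᴾ :* (X₀ :* X₁ :+ X₁ :* X₀)) ≡.refl
    }
    where
    embᴾ : Polynomial 5 → Polynomial 5 → KPoly 3
    embᴾ p q = ⟪ p , q , 0ᴾ , 0ᴾ ⟫

  K₂ : QuadraticSubfield
  K₂ = record
    { δ = false , true ; In = InK₂ ; coord = x₂ ; emb = λ p q → ⟨ p , 0# , q , 0# ⟩ ; ρ = σ
    ; In-emb        = λ _ _ → refl , refl
    ; In⇒≈emb       = λ (w₁≈0 , w₃≈0) → refl , w₁≈0 , refl , w₃≈0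
    ; coord-zero    = λ (_ , _ , e₂ , _) → e₂
    ; emb-cong      = λ p≈p′ q≈q′ → p≈p′ , refl , q≈q′ , refl
    ; emb-injective = λ (e₀ , _ , e₂ , _) → e₀ , e₂
    ; ι≈emb         = λ _ → ≈K-refl
    ; ι*emb²        = λ e p q → proveᴷ (e ∷ p ∷ q ∷ []) (ιᴾ E ⊛ (embᴾ P Q ⊛ embᴾ P Q))
                        (embᴾ (E :* (P :* P :+ A₂ :* (Q :* Q))) (E :* (P :* Q :+ Q :* P))) ≡.refl
    ; norm-In       = λ z → proveᴾ (coordinates z) (π₁ (N₂ᴾ X)) 0ᴾ ≡.refl ,
                            proveᴾ (coordinates z) (π₃ (N₂ᴾ X)) 0ᴾ ≡.refl
    ; norm-square   = λ z → proveᴷ (coordinates z) (N₂ᴾ X ⊛ N₂ᴾ X) ((X ⊛ X) ⊛ (σᴾ X ⊛ σᴾ X)) ≡.refl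
    ; trace₀        = λ z → proveᴾ (coordinates z) (π₀ (X ⊛ X) :+ π₀ (N₂ᴾ X))
                            (2ᴾ :* (X₀ :* X₀ :+ A₂ :* (X₂ :* X₂))) ≡.refl
    ; trace₁        = λ z → proveᴾ (coordinates z) (π₂ (X ⊛ X) :+ π₂ (N₂ᴾ X))
                            (2ᴾ :* (X₀ :* X₂ :+ X₂ :* X₀)) ≡.refl
    }
    where
    embᴾ : Polynomial 5 → Polynomial 5 → KPoly 3
    embᴾ p q = ⟪ p , 0ᴾ , q , 0ᴾ ⟫

  K₃ : QuadraticSubfield
  K₃ = record
    { δ = true , true ; In = InK₃ ; coord = x₃ ; emb = λ p q → ⟨ p , 0# , 0# , q ⟩ ; ρ = στ
    ; In-emb        = λ _ _ → refl , refl
    ; In⇒≈emb       = λ (w₁≈0 , w₂≈0) → refl , w₁≈0 , w₂≈0 , refl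
    ; coord-zero    = λ (_ , _ , _ , e₃) → e₃
    ; emb-cong      = λ p≈p′ q≈q′ → p≈p′ , refl , refl , q≈q′
    ; emb-injective = λ (e₀ , _ , _ , e₃) → e₀ , e₃
    ; ι≈emb         = λ _ → ≈K-refl
    ; ι*emb²        = λ e p q → proveᴷ (e ∷ p ∷ q ∷ []) (ιᴾ E ⊛ (embᴾ P Q ⊛ embᴾ P Q))
                        (embᴾ (E :* (P :* P :+ (A₁ :* A₂) :* (Q :* Q))) (E :* (P :* Q :+ Q :* P))) ≡.refl
    ; norm-In       = λ z → proveᴾ (coordinates z) (π₁ (N₃ᴾ X)) 0ᴾ ≡.refl ,
                            proveᴾ (coordinates z) (π₂ (N₃ᴾ X)) 0ᴾ ≡.refl
    ; norm-square   = λ z → proveᴷ (coordinates z) (N₃ᴾ X ⊛ N₃ᴾ X) ((X ⊛ X) ⊛ (στᴾ X ⊛ στᴾ X)) ≡.refl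
    ; trace₀        = λ z → proveᴾ (coordinates z) (π₀ (X ⊛ X) :+ π₀ (N₃ᴾ X))
                            (2ᴾ :* (X₀ :* X₀ :+ (A₁ :* A₂) :* (X₃ :* X₃))) ≡.refl
    ; trace₁        = λ z → proveᴾ (coordinates z) (π₃ (X ⊛ X) :+ π₃ (N₃ᴾ X))
                            (2ᴾ :* (X₀ :* X₃ :+ X₃ :* X₀)) ≡.refl
    }
    where
    embᴾ : Polynomial 5 → Polynomial 5 → KPoly 3
    embᴾ p q = ⟪ p , 0ᴾ , 0ᴾ , q ⟫

  infix 4 _≡[_]_
  _≡[_]_ : K → QuadraticSubfield → K → Set (c ⊔ ℓ)
  x ≡[ S ] y = ∃ λ z → QuadraticSubfield.In S z × NonzeroK z × (x ≈K y *K (z *K z))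

  ≡[]-respˡ : ∀ S {x x′ y} → x ≈K x′ → x ≡[ S ] y → x′ ≡[ S ] y
  ≡[]-respˡ S x≈x′ (z , z∈S , z≉0 , x≈yz²) = z , z∈S , z≉0 , ≈K-trans (≈K-sym x≈x′) x≈yz²

  ⟦_⟧ᴾ : Code → Polynomial 2
  ⟦ false , false ⟧ᴾ = 1ᴾ
  ⟦ true  , false ⟧ᴾ = A₁
  ⟦ false , true  ⟧ᴾ = A₂
  ⟦ true  , true  ⟧ᴾ = A₁ :* A₂

  ⟦⟧ᴾ-correct : ∀ u → ⟦ ⟦ u ⟧ᴾ ⟧ₚ (a₁ ∷ a₂ ∷ []) ≡ ⟦ u ⟧
  ⟦⟧ᴾ-correct (false , false) = ≡.refl
  ⟦⟧ᴾ-correct (true  , false) = ≡.refl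
  ⟦⟧ᴾ-correct (false , true ) = ≡.refl
  ⟦⟧ᴾ-correct (true  , true ) = ≡.refl

  ⟦⟧-*-≈ : ∀ u v → ⟦ u ⟧ * ⟦ v ⟧ ≈ ⟦ u ⊕ v ⟧ * (⟦ u ∧ᶜ v ⟧ * ⟦ u ∧ᶜ v ⟧)
  ⟦⟧-*-≈ u v = begin
    ⟦ u ⟧ * ⟦ v ⟧                                  ≡⟨ ≡.cong₂ _*_ (⟦⟧ᴾ-correct u) (⟦⟧ᴾ-correct v) ⟨
    ⟦ ⟦ u ⟧ᴾ :* ⟦ v ⟧ᴾ ⟧ₚ ρ                        ≈⟨ proveᴾ [] (⟦ u ⟧ᴾ :* ⟦ v ⟧ᴾ)
                                                         (⟦ u ⊕ v ⟧ᴾ :* (⟦ u ∧ᶜ v ⟧ᴾ :* ⟦ u ∧ᶜ v ⟧ᴾ)) (normal-forms u v) ⟩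
    ⟦ ⟦ u ⊕ v ⟧ᴾ :* (⟦ u ∧ᶜ v ⟧ᴾ :* ⟦ u ∧ᶜ v ⟧ᴾ) ⟧ₚ ρ ≡⟨ ≡.cong₂ (λ s t → s * (t * t)) (⟦⟧ᴾ-correct (u ⊕ v))
                                                                                (⟦⟧ᴾ-correct (u ∧ᶜ v)) ⟩
    ⟦ u ⊕ v ⟧ * (⟦ u ∧ᶜ v ⟧ * ⟦ u ∧ᶜ v ⟧)           ∎
    where
    open import Relation.Binary.Reasoning.Setoid setoid
    ρ = a₁ ∷ a₂ ∷ []
    normal-forms : ∀ u v → normalise (⟦ u ⟧ᴾ :* ⟦ v ⟧ᴾ) ≡
                           normalise (⟦ u ⊕ v ⟧ᴾ :* (⟦ u ∧ᶜ v ⟧ᴾ :* ⟦ u ∧ᶜ v ⟧ᴾ))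
    normal-forms (false , false) (false , false) = ≡.refl
    normal-forms (false , false) (true  , false) = ≡.refl
    normal-forms (false , false) (false , true ) = ≡.refl
    normal-forms (false , false) (true  , true ) = ≡.refl
    normal-forms (true  , false) (false , false) = ≡.refl
    normal-forms (true  , false) (true  , false) = ≡.refl
    normal-forms (true  , false) (false , true ) = ≡.refl
    normal-forms (true  , false) (true  , true ) = ≡.refl
    normal-forms (false , true ) (false , false) = ≡.refl
    normal-forms (false , true ) (true  , false) = ≡.refl
    normal-forms (false , true ) (false , true ) = ≡.refl
    normal-forms (false , true ) (true  , true ) = ≡.refl
    normal-forms (true  , true ) (false , false) = ≡.refl
    normal-forms (true  , true ) (true  , false) = ≡.refl
    normal-forms (true  , true ) (false , true ) = ≡.refl
    normal-forms (true  , true ) (true  , true ) = ≡.refl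

  infix 4 _∈_+⟨_⟩
  data _∈_+⟨_⟩ : Code → Code → Code → Set where
    here  : ∀ {c δ} → c ∈ c +⟨ δ ⟩
    there : ∀ {c δ} → c ⊕ δ ∈ c +⟨ δ ⟩

  -- Classically, the square class of n is ⟦ u ⟧ or ⟦ v ⟧.
  record OneOf (n : Carrier) (u v : Code) : Set (c ⊔ ℓ) where
    field
      ¬v⇒u : ¬ n ∼ ⟦ v ⟧ → n ∼ ⟦ u ⟧
      ¬u⇒v : ¬ n ∼ ⟦ u ⟧ → n ∼ ⟦ v ⟧
  open OneOf

  OneOf-swap : ∀ {n u v} → OneOf n u v → OneOf n v u
  OneOf-swap o = record { ¬v⇒u = ¬u⇒v o ; ¬u⇒v = ¬v⇒u o }

  module Nondegenerate (2≉0 : ¬ 1# + 1# ≈ 0#)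
           (a₁-nonsquare : ¬ IsSquare a₁) (a₂-nonsquare : ¬ IsSquare a₂) (a₁a₂-nonsquare : ¬ IsSquare (a₁ * a₂))
           where

    ⟦⟧≉0 : ∀ u → ¬ ⟦ u ⟧ ≈ 0#
    ⟦⟧≉0 (false , false) = 1≉0
    ⟦⟧≉0 (true  , false) = nonsquare⇒≉0 a₁-nonsquare
    ⟦⟧≉0 (false , true ) = nonsquare⇒≉0 a₂-nonsquare
    ⟦⟧≉0 (true  , true ) = nonsquare⇒≉0 a₁a₂-nonsquare

    ⟦⟧-*-∼ : ∀ u v → ⟦ u ⟧ * ⟦ v ⟧ ∼ ⟦ u ⊕ v ⟧
    ⟦⟧-*-∼ u v = ⟦ u ∧ᶜ v ⟧ , ⟦⟧≉0 (u ∧ᶜ v) , ⟦⟧-*-≈ u v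

    ⟦⟧∼1⇒0ᶜ : ∀ u → ⟦ u ⟧ ∼ 1# → u ≡ 0ᶜ
    ⟦⟧∼1⇒0ᶜ (false , false) _   = ≡.refl
    ⟦⟧∼1⇒0ᶜ (true  , false) u∼1 = ⊥-elim (a₁-nonsquare (∼1⇒IsSquare u∼1))
    ⟦⟧∼1⇒0ᶜ (false , true ) u∼1 = ⊥-elim (a₂-nonsquare (∼1⇒IsSquare u∼1))
    ⟦⟧∼1⇒0ᶜ (true  , true ) u∼1 = ⊥-elim (a₁a₂-nonsquare (∼1⇒IsSquare u∼1))

    ⟦⟧-∼-injective : ∀ {u v} → ⟦ u ⟧ ∼ ⟦ v ⟧ → u ≡ v
    ⟦⟧-∼-injective {u} {v} u∼v = ≡.sym (⊕-cancelˡ u (≡.trans (⟦⟧∼1⇒0ᶜ (u ⊕ v) u⊕v∼1) (≡.sym (⊕-self u))))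
      where
      u⊕v∼1 : ⟦ u ⊕ v ⟧ ∼ 1#
      u⊕v∼1 = ∼-trans (∼-sym (⟦⟧-*-∼ u v)) (∼-trans (∼-*-congʳ u∼v) (x*x∼1 (⟦⟧≉0 v)))

    OneOf-pin : ∀ {n u v v′} → OneOf n u v → OneOf n u v′ → v ≢ u → v ≢ v′ → n ∼ ⟦ u ⟧
    OneOf-pin o o′ v≢u v≢v′ = ¬v⇒u o λ n∼v →
      v≢v′ (⟦⟧-∼-injective (∼-trans (∼-sym n∼v) (¬u⇒v o′ λ n∼u →
      v≢u (⟦⟧-∼-injective (∼-trans (∼-sym n∼v) n∼u)))))

    module _ (S : QuadraticSubfield) where
      open QuadraticSubfield S
      open import Relation.Binary.Reasoning.Setoid setoid
      module K≈ = SetoidReasoning K-setoid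

      ι-≡[]-intro : ∀ {n e p q} → ¬ (p ≈ 0# × q ≈ 0#) → n ≈ e * (p * p + ⟦ δ ⟧ * (q * q)) →
                    e * (p * q + q * p) ≈ 0# → ι n ≡[ S ] ι e
      ι-≡[]-intro {n} {e} {p} {q} ¬p,q≈0 n≈ew² ew₁≈0 = emb p q , In-emb p q , w≉0 , (K≈.begin
        ι n                                                           K≈.≈⟨ ι≈emb n ⟩
        emb n 0#                                                      K≈.≈⟨ emb-cong n≈ew² (sym ew₁≈0) ⟩
        emb (e * (p * p + ⟦ δ ⟧ * (q * q))) (e * (p * q + q * p))     K≈.≈⟨ ι*emb² e p q ⟨
        ι e *K (emb p q *K emb p q)                                   K≈.∎)
        where
        w≉0 : NonzeroK (emb p q)
        w≉0 w≈0 = ¬p,q≈0 (emb-injective (≈K-trans w≈0 (ι≈emb 0#)))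

      ι-≡[]-elim : ∀ {n e} → ι n ≡[ S ] ι e → ∃ λ p → ∃ λ q → ¬ (p ≈ 0# × q ≈ 0#) ×
                   n ≈ e * (p * p + ⟦ δ ⟧ * (q * q)) × e * (p * q + q * p) ≈ 0#
      ι-≡[]-elim {n} {e} (w , w∈S , w≉0 , n≈ew²) = p , q , ¬p,q≈0 , proj₁ coordinates≈ , sym (proj₂ coordinates≈)
        where
        p = x₀ w
        q = coord w
        ¬p,q≈0 : ¬ (p ≈ 0# × q ≈ 0#)
        ¬p,q≈0 (p≈0 , q≈0) = w≉0 (≈K-trans (In⇒≈emb w∈S) (≈K-trans (emb-cong p≈0 q≈0) (≈K-sym (ι≈emb 0#))))
        coordinates≈ = emb-injective (K≈.begin
          emb n 0#                                                      K≈.≈⟨ ι≈emb n ⟨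
          ι n                                                           K≈.≈⟨ n≈ew² ⟩
          ι e *K (w *K w)                                               K≈.≈⟨ *K-congˡ (*K-cong (In⇒≈emb w∈S) (In⇒≈emb w∈S)) ⟩
          ι e *K (emb p q *K emb p q)                                   K≈.≈⟨ ι*emb² e p q ⟩
          emb (e * (p * p + ⟦ δ ⟧ * (q * q))) (e * (p * q + q * p))     K≈.∎)

      ∼⇒≡[] : ∀ {n e} → n ∼ e → ι n ≡[ S ] ι e
      ∼⇒≡[] {n} {e} (x , x≉0 , n≈ex²) = ι-≡[]-intro (λ (x≈0 , _) → x≉0 x≈0)
        (trans n≈ex² (solve 3 (λ e d x → e :* (x :* x) := e :* (x :* x :+ d :* (0ᴾ :* 0ᴾ))) refl e ⟦ δ ⟧ x))
        (solve 2 (λ e x → e :* (x :* 0ᴾ :+ 0ᴾ :* x) := 0ᴾ) refl e x)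

      ∼*d⇒≡[] : ∀ {n e} → n ∼ e * ⟦ δ ⟧ → ι n ≡[ S ] ι e
      ∼*d⇒≡[] {n} {e} (x , x≉0 , n≈edx²) = ι-≡[]-intro (λ (_ , x≈0) → x≉0 x≈0)
        (trans n≈edx² (solve 3 (λ e d x → (e :* d) :* (x :* x) := e :* (0ᴾ :* 0ᴾ :+ d :* (x :* x))) refl e ⟦ δ ⟧ x))
        (solve 2 (λ e x → e :* (0ᴾ :* x :+ x :* 0ᴾ) := 0ᴾ) refl e x)

      ∼⊕δ⇒≡[] : ∀ {n u} → n ∼ ⟦ u ⊕ δ ⟧ → ι n ≡[ S ] ι ⟦ u ⟧
      ∼⊕δ⇒≡[] {u = u} n∼u⊕δ = ∼*d⇒≡[] (∼-trans n∼u⊕δ (∼-sym (⟦⟧-*-∼ u δ)))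

      ≡[]⇒OneOf : ∀ {n u} → ι n ≡[ S ] ι ⟦ u ⟧ → OneOf n u (u ⊕ δ)
      ≡[]⇒OneOf {n} {u} n≡u with ι-≡[]-elim n≡u
      ... | p , q , ¬p,q≈0 , n≈ew² , ew₁≈0 = record
        { ¬v⇒u = λ n≁u⊕δ → let p≉0 = λ p≈0 → n≁u⊕δ (n∼u⊕δ p≈0 (λ q≈0 → ¬p,q≈0 (p≈0 , q≈0))) in
                            n∼u (x*y≈0⇒y≈0 p≉0 pq≈0) p≉0
        ; ¬u⇒v = λ n≁u → let q≉0 = λ q≈0 → n≁u (n∼u q≈0 (λ p≈0 → ¬p,q≈0 (p≈0 , q≈0))) in
                          n∼u⊕δ (x*y≈0⇒y≈0 q≉0 (trans (*-comm q p) pq≈0)) q≉0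
        }
        where
        e = ⟦ u ⟧
        pq≈0 : p * q ≈ 0#
        pq≈0 = x*y+y*x≈0⇒x*y≈0 2≉0 (x*y≈0⇒y≈0 (⟦⟧≉0 u) ew₁≈0)
        n∼u : q ≈ 0# → ¬ p ≈ 0# → n ∼ e
        n∼u q≈0 p≉0 = p , p≉0 , (begin
          n                                  ≈⟨ n≈ew² ⟩
          e * (p * p + ⟦ δ ⟧ * (q * q))      ≈⟨ *-congˡ (+-congˡ (*-congˡ (*-cong q≈0 q≈0))) ⟩
          e * (p * p + ⟦ δ ⟧ * (0# * 0#))    ≈⟨ solve 3 (λ e d p → e :* (p :* p :+ d :* (0ᴾ :* 0ᴾ))
                                                                := e :* (p :* p)) refl e ⟦ δ ⟧ p ⟩
          e * (p * p)                        ∎)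
        n∼u⊕δ : p ≈ 0# → ¬ q ≈ 0# → n ∼ ⟦ u ⊕ δ ⟧
        n∼u⊕δ p≈0 q≉0 = ∼-trans (q , q≉0 , (begin
          n                                  ≈⟨ n≈ew² ⟩
          e * (p * p + ⟦ δ ⟧ * (q * q))      ≈⟨ *-congˡ (+-congʳ (*-cong p≈0 p≈0)) ⟩
          e * (0# * 0# + ⟦ δ ⟧ * (q * q))    ≈⟨ solve 3 (λ e d q → e :* (0ᴾ :* 0ᴾ :+ d :* (q :* q))
                                                                := (e :* d) :* (q :* q)) refl e ⟦ δ ⟧ q ⟩
          (e * ⟦ δ ⟧) * (q * q)              ∎)) (⟦⟧-*-∼ u δ)

      In-square≈0⇒¬¬≈0 : ∀ {y} → In y → y *K y ≈K 0K → ¬ ¬ (x₀ y ≈ 0# × coord y ≈ 0#)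
      In-square≈0⇒¬¬≈0 {y} y∈S y²≈0 = quadratic-square≈0⇒¬¬≈0 2≉0 (⟦⟧≉0 δ)
        (trans (sym (*-identityˡ _)) (proj₁ coordinates≈0)) (trans (sym (*-identityˡ _)) (proj₂ coordinates≈0))
        where
        p = x₀ y
        q = coord y
        coordinates≈0 = emb-injective (K≈.begin
          emb (1# * (p * p + ⟦ δ ⟧ * (q * q))) (1# * (p * q + q * p))   K≈.≈⟨ ι*emb² 1# p q ⟨
          1K *K (emb p q *K emb p q)                                     K≈.≈⟨ *K-identityˡ _ ⟩
          emb p q *K emb p q                                             K≈.≈⟨ *K-cong (In⇒≈emb y∈S) (In⇒≈emb y∈S) ⟨
          y *K y                                                         K≈.≈⟨ y²≈0 ⟩
          0K                                                             K≈.≈⟨ ι≈emb 0# ⟩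
          emb 0# 0#                                                      K≈.∎)

      -- The norm z ρ z lies in F(√d) and squares to z² (ρ z)² = 0, so it vanishes; then the traces say that
      -- (x₀ z + coord z √d)² = 0.
      square≈0⇒¬¬≈0 : ∀ {z} → z *K z ≈K 0K → ¬ ¬ (x₀ z ≈ 0# × coord z ≈ 0#)
      square≈0⇒¬¬≈0 {z} z²≈0 = λ k → In-square≈0⇒¬¬≈0 (norm-In z) norm²≈0 λ (norm₀≈0 , norm₁≈0) →
        quadratic-square≈0⇒¬¬≈0 2≉0 (⟦⟧≉0 δ)
          (x*y≈0⇒y≈0 2≉0 (trans (sym (trace₀ z)) (trans (+-cong (proj₁ z²≈0) norm₀≈0) (+-identityˡ 0#))))
          (x*y≈0⇒y≈0 2≉0 (trans (sym (trace₁ z)) (trans (+-cong (coord-zero z²≈0) norm₁≈0) (+-identityˡ 0#))))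
          k
        where
        norm²≈0 : (z *K ρ z) *K (z *K ρ z) ≈K 0K
        norm²≈0 = ≈K-trans (norm-square z) (≈K-trans (*K-cong z²≈0 ≈K-refl) (*K-zeroˡ _))

      coset-∼⇒≡[] : ∀ {n c u} → u ∈ c +⟨ δ ⟩ → n ∼ ⟦ c ⟧ → ι n ≡[ S ] ι ⟦ u ⟧
      coset-∼⇒≡[] here                n∼c = ∼⇒≡[] n∼c
      coset-∼⇒≡[] {n} {c} there n∼c = ∼⊕δ⇒≡[] {u = c ⊕ δ} (≡.subst (λ w → n ∼ ⟦ w ⟧) (≡.sym (⊕-involutive c δ)) n∼c)

      coset-≡[]⇒OneOf : ∀ {n c u} → u ∈ c +⟨ δ ⟩ → ι n ≡[ S ] ι ⟦ u ⟧ → OneOf n c (c ⊕ δ)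
      coset-≡[]⇒OneOf here              n≡u = ≡[]⇒OneOf n≡u
      coset-≡[]⇒OneOf {n} {c} there n≡u = OneOf-swap (≡.subst (OneOf n (c ⊕ δ)) (⊕-involutive c δ) (≡[]⇒OneOf {u = c ⊕ δ} n≡u))

    classes-via-subfields : ∀ (S S′ : QuadraticSubfield) {n c u v} → let open QuadraticSubfield in
      δ S ≢ 0ᶜ → δ S ≢ δ S′ → u ∈ c +⟨ δ S ⟩ → v ∈ c +⟨ δ S′ ⟩ →
      n ∼ ⟦ c ⟧ ⇔ (ι n ≡[ S ] ι ⟦ u ⟧ × ι n ≡[ S′ ] ι ⟦ v ⟧)
    classes-via-subfields S S′ {c = c} δ≢0 δ≢δ′ u∈ v∈ = mk⇔
      (λ n∼c → coset-∼⇒≡[] S u∈ n∼c , coset-∼⇒≡[] S′ v∈ n∼c)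
      (λ (n≡u , n≡v) → OneOf-pin (coset-≡[]⇒OneOf S u∈ n≡u) (coset-≡[]⇒OneOf S′ v∈ n≡v)
        (λ c⊕δ≡c → δ≢0 (⊕-cancelˡ c (≡.trans c⊕δ≡c (≡.sym (⊕-identityʳ c)))))
        (λ c⊕δ≡c⊕δ′ → δ≢δ′ (⊕-cancelˡ c c⊕δ≡c⊕δ′)))

    K-reduced : ∀ {z} → z *K z ≈K 0K → ¬ ¬ z ≈K 0K
    K-reduced z²≈0 k =
      square≈0⇒¬¬≈0 K₁ z²≈0 λ (z₀≈0 , z₁≈0) →
      square≈0⇒¬¬≈0 K₂ z²≈0 λ (_ , z₂≈0) →
      square≈0⇒¬¬≈0 K₃ z²≈0 λ (_ , z₃≈0) →
      k (z₀≈0 , z₁≈0 , z₂≈0 , z₃≈0)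

    ≈⇒≡J : ∀ {x y} → x ≈K y → x ≡J y
    ≈⇒≡J {x} {y} x≈y = 1K , (λ (1≈0 , _) → 1≉0 1≈0) ,
      ≈K-trans x≈y (≈K-sym (≈K-trans (*K-comm y (1K *K 1K)) (≈K-trans (*K-cong (*K-identityˡ 1K) ≈K-refl) (*K-identityˡ y))))

    ≡J-respˡ : ∀ {x x′ y} → x ≈K x′ → x ≡J y → x′ ≡J y
    ≡J-respˡ x≈x′ (z , z≉0 , x≈yz²) = z , z≉0 , ≈K-trans (≈K-sym x≈x′) x≈yz²

    -- x y = z² with z² ∈ F^× gives y = x (y z / z²)².
    ≡J-of-norm : ∀ {x y z n} → x *K y ≈K ι n → z *K z ≈K ι n → ¬ n ≈ 0# → y ≡J x
    ≡J-of-norm {x} {y} {z} {n} xy≈n z²≈n n≉0 = w , w≉0 , CM.square-ratio xy≈n z²≈n nn⁻¹≈1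
      where
      module CM = CommutativeMonoidProperties *K-commutativeMonoid
      n⁻¹ = proj₁ (inverse n n≉0)
      nn⁻¹≈1 : ι n *K ι n⁻¹ ≈K 1K
      nn⁻¹≈1 = ≈K-trans (ι-* n n⁻¹) (ι-cong (proj₂ (inverse n n≉0)))
      w = y *K (ι n⁻¹ *K z)
      w≉0 : NonzeroK w
      w≉0 w≈0 = *K≈ι⇒≉0 (≈K-trans (*K-comm y x) xy≈n) n≉0
        (≈K-trans (CM.square-ratio-root z²≈n nn⁻¹≈1) (≈K-trans (*K-cong w≈0 ≈K-refl) (*K-zeroˡ z)))

    module TrivialNormClass {γ z : K} (z≉0 : NonzeroK z) (Nγ≈z² : N γ ≈K 1K *K (z *K z)) where
      n : Carrier
      n = x₀ (N γ)

      Nγ≈n : N γ ≈K ι n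
      Nγ≈n = N≈ι γ

      z²≈n : z *K z ≈K ι n
      z²≈n = ≈K-trans (≈K-sym (*K-identityˡ _)) (≈K-trans (≈K-sym Nγ≈z²) Nγ≈n)

      n≉0 : ¬ n ≈ 0#
      n≉0 n≈0 = K-reduced (≈K-trans z²≈n (ι-cong n≈0)) z≉0

      N₁γ-InJG : InJG (N₁ γ)
      N₁γ-InJG = σ-case , ≈⇒≡J (τ∘N₁≈N₁ γ) , ≡J-respˡ (≈K-sym (στ∘N₁≈σ∘N₁ γ)) σ-case
        where
        σ-case = ≡J-of-norm (≈K-trans (N₂∘N₁≈N γ) Nγ≈n) z²≈n n≉0

      N₂γ-InJG : InJG (N₂ γ)
      N₂γ-InJG = ≈⇒≡J (σ∘N₂≈N₂ γ) , τ-case , ≡J-respˡ (≈K-sym (στ∘N₂≈τ∘N₂ γ)) τ-case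
        where
        τ-case = ≡J-of-norm (≈K-trans (N₁∘N₂≈N γ) Nγ≈n) z²≈n n≉0

      ≡F⇔∼ : ∀ {e} → N γ ≡F e ⇔ n ∼ e
      ≡F⇔∼ = mk⇔ (λ (x , x≉0 , Nγ≈ex²) → x , x≉0 , proj₁ (≈K-trans (≈K-sym Nγ≈n) Nγ≈ex²))
                 (λ (x , x≉0 , n≈ex²) → x , x≉0 , ≈K-trans Nγ≈n (ι-cong n≈ex²))

      T-N₁⇔ : ∀ {v w} → T N₁ γ ≣⟨ 1K , v , w ⟩ ⇔ (ι n ≡[ K₂ ] v × ι n ≡[ K₃ ] w)
      T-N₁⇔ = mk⇔ (λ (_ , N₂N₁γ≡v , N₃N₁γ≡w) → ≡[]-respˡ K₂ N₂N₁γ≈n N₂N₁γ≡v , ≡[]-respˡ K₃ N₃N₁γ≈n N₃N₁γ≡w)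
                  (λ (n≡v , n≡w) → N₁N₁γ≡1 , ≡[]-respˡ K₂ (≈K-sym N₂N₁γ≈n) n≡v , ≡[]-respˡ K₃ (≈K-sym N₃N₁γ≈n) n≡w)
        where
        N₂N₁γ≈n = ≈K-trans (N₂∘N₁≈N γ) Nγ≈n
        N₃N₁γ≈n = ≈K-trans (N₃∘N₁≈N γ) Nγ≈n
        N₁N₁γ≡1 : N₁ (N₁ γ) ≡[ K₁ ] 1K
        N₁N₁γ≡1 = N₁ γ , QuadraticSubfield.norm-In K₁ γ , *K≈ι⇒≉0 N₂N₁γ≈n n≉0 ,
                  ≈K-trans (*K-congˡ (τ∘N₁≈N₁ γ)) (≈K-sym (*K-identityˡ _))

      T-N₂⇔ : ∀ {u w} → T N₂ γ ≣⟨ u , 1K , w ⟩ ⇔ (ι n ≡[ K₁ ] u × ι n ≡[ K₃ ] w)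
      T-N₂⇔ = mk⇔ (λ (N₁N₂γ≡u , _ , N₃N₂γ≡w) → ≡[]-respˡ K₁ N₁N₂γ≈n N₁N₂γ≡u , ≡[]-respˡ K₃ N₃N₂γ≈n N₃N₂γ≡w)
                  (λ (n≡u , n≡w) → ≡[]-respˡ K₁ (≈K-sym N₁N₂γ≈n) n≡u , N₂N₂γ≡1 , ≡[]-respˡ K₃ (≈K-sym N₃N₂γ≈n) n≡w)
        where
        N₁N₂γ≈n = ≈K-trans (N₁∘N₂≈N γ) Nγ≈n
        N₃N₂γ≈n = ≈K-trans (N₃∘N₂≈N γ) Nγ≈n
        N₂N₂γ≡1 : N₂ (N₂ γ) ≡[ K₂ ] 1K
        N₂N₂γ≡1 = N₂ γ , QuadraticSubfield.norm-In K₂ γ , *K≈ι⇒≉0 N₁N₂γ≈n n≉0 ,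
                  ≈K-trans (*K-congˡ (σ∘N₂≈N₂ γ)) (≈K-sym (*K-identityˡ _))

      classes : ∀ c {u₂ u₃ v₁ v₃} → let open QuadraticSubfield in
        u₂ ∈ c +⟨ δ K₂ ⟩ → u₃ ∈ c +⟨ δ K₃ ⟩ → v₁ ∈ c +⟨ δ K₁ ⟩ → v₃ ∈ c +⟨ δ K₃ ⟩ →
        Equiv3 (N γ ≡F ⟦ c ⟧) (T N₁ γ ≣⟨ 1K , ι ⟦ u₂ ⟧ , ι ⟦ u₃ ⟧ ⟩) (T N₂ γ ≣⟨ ι ⟦ v₁ ⟧ , 1K , ι ⟦ v₃ ⟧ ⟩)
      classes c u₂∈ u₃∈ v₁∈ v₃∈ = F⇔T₁ , ⇔-trans (⇔-sym F⇔T₁) F⇔T₂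
        where
        F⇔T₁ = ⇔-trans ≡F⇔∼ (⇔-trans (classes-via-subfields K₂ K₃ (λ ()) (λ ()) u₂∈ u₃∈) (⇔-sym T-N₁⇔))
        F⇔T₂ = ⇔-trans ≡F⇔∼ (⇔-trans (classes-via-subfields K₁ K₃ (λ ()) (λ ()) v₁∈ v₃∈) (⇔-sym T-N₂⇔))

lemma4p3 : ∀ {c ℓ} (F : Field c ℓ) (a₁ a₂ : Field.Carrier F) →
    let open Field F
        open Biquadratic F a₁ a₂
    in ¬ (1# + 1# ≈ 0#) →
       ¬ (∃ λ x → x * x ≈ a₁) →
       ¬ (∃ λ x → x * x ≈ a₂) →
       ¬ (∃ λ x → x * x ≈ a₁ * a₂) →
       (γ : K) → NonzeroK γ → N γ ≡J 1K →
       InJG (N₁ γ) × InJG (N₂ γ)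
       × Equiv3 (N γ ≡F 1#) (T N₁ γ ≣⟨ 1K , 1K , 1K ⟩) (T N₂ γ ≣⟨ 1K , 1K , 1K ⟩)
       × Equiv3 (N γ ≡F a₁) (T N₁ γ ≣⟨ 1K , ι a₁ , ι a₁ ⟩) (T N₂ γ ≣⟨ 1K , 1K , ι a₁ ⟩)
       × Equiv3 (N γ ≡F a₂) (T N₁ γ ≣⟨ 1K , 1K , ι a₁ ⟩) (T N₂ γ ≣⟨ ι a₂ , 1K , ι a₁ ⟩)
       × Equiv3 (N γ ≡F (a₁ * a₂)) (T N₁ γ ≣⟨ 1K , ι a₁ , 1K ⟩) (T N₂ γ ≣⟨ ι a₂ , 1K , 1K ⟩)
lemma4p3 F a₁ a₂ 2≉0 a₁-nonsquare a₂-nonsquare a₁a₂-nonsquare γ _ (z , z≉0 , Nγ≈z²) =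
    N₁γ-InJG , N₂γ-InJG
  , classes (false , false) here  here  here  here
  , classes (true  , false) here  here  there here
  , classes (false , true ) there there here  there
  , classes (true  , true ) there there there there
  where
  open BiquadraticProperties F a₁ a₂
  open Nondegenerate 2≉0 a₁-nonsquare a₂-nonsquare a₁a₂-nonsquare
  open TrivialNormClass z≉0 Nγ≈z²
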